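{- Let $G=(V,E)$ be a finite simple connected graph, let $u_1\in V$ and let $u_2\notin V$ be a new vertex. Let $G_{out}=(V\cup\{u_2\},E\cup\{\{u_1,u_2\}\})$. If $G$ is separable, then $G_{out}$ is separable.
   Context: A graph $G=(V,E)$ is separable if there exist non-negative real weights $w(e)$, $e\in E$, and a threshold $\alpha\in\mathbb{R}$ such that for every $E'\subseteq E$: $\sum_{e\in E'}w(e)\ge\alpha$ if and only if the spanning subgraph $(V,E')$ is connected.
   Formalization: The weights $w(e)$ and the threshold $\alpha$ in the notion of separability are rational rather than real. -}

module Defs where

open import Data.Nat using (ℕ; zero; suc)
open import Data.Fin using (Fin; zero; suc; inject₁; fromℕ) renaming (_<_ to _<ᶠ_)
open import Data.Bool using (Bool; true; false; if_then_else_)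
open import Data.Product using (_×_; _,_; proj₁; proj₂; ∃-syntax; Σ-syntax)
open import Data.Rational using (ℚ; 0ℚ; _+_; _≤_)
open import Relation.Binary.PropositionalEquality using (_≡_)
open import Function.Definitions using (Injective)
open import Function.Bundles using (_⇔_)

record Graph : Set where
  constructor graph
  field
    n    : ℕ
    m    : ℕ
    ends : Fin m → Fin n × Fin n

open Graph public

-- Simple: every edge is stored as (a , b) with a < b (so no loops, and an
-- unordered pair has a unique representation), and distinct edge labels
-- denote distinct pairs (no multi-edges).
IsSimple : Graph → Set
IsSimple G = (∀ i → proj₁ (ends G i) <ᶠ proj₂ (ends G i))
           × Injective _≡_ _≡_ (ends G)

EdgeSet : Graph → Set
EdgeSet G = Fin (m G) → Bool

data Reach (G : Graph) (S : EdgeSet G) : Fin (n G) → Fin (n G) → Set where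
  here  : ∀ {x} → Reach G S x x
  fwd   : ∀ {x z} (i : Fin (m G)) → S i ≡ true →
          Reach G S x (proj₁ (ends G i)) → z ≡ proj₂ (ends G i) → Reach G S x z
  bwd   : ∀ {x z} (i : Fin (m G)) → S i ≡ true →
          Reach G S x (proj₂ (ends G i)) → z ≡ proj₁ (ends G i) → Reach G S x z

SpanConnected : (G : Graph) → EdgeSet G → Set
SpanConnected G S = ∀ x y → Reach G S x y

allEdges : (G : Graph) → EdgeSet G
allEdges G _ = true

Connected : Graph → Set
Connected G = SpanConnected G (allEdges G)

sumSel : ∀ {k} → (Fin k → ℚ) → (Fin k → Bool) → ℚ
sumSel {zero}  w S = 0ℚ
sumSel {suc k} w S = (if S zero then w zero else 0ℚ) + sumSel (λ i → w (suc i)) (λ i → S (suc i))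

Separable : Graph → Set
Separable G = ∃[ w ] ∃[ α ]
  ((∀ i → 0ℚ ≤ w i) ×
   (∀ (S : EdgeSet G) → (α ≤ sumSel w S) ⇔ SpanConnected G S))

-- G_out: add new vertex u₂ = fromℕ n (the last vertex of Fin (suc n)),
-- and a new edge {u₁ , u₂} (edge label zero); old vertices/edges embed via
-- inject₁ / suc.
addPendant : (G : Graph) → Fin (n G) → Graph
addPendant (graph n m e) u₁ = graph (suc n) (suc m) e'
  where
  e' : Fin (suc m) → Fin (suc n) × Fin (suc n)
  e' zero    = inject₁ u₁ , fromℕ n
  e' (suc i) = inject₁ (proj₁ (e i)) , inject₁ (proj₂ (e i))

{-# OPTIONS --safe #-}
-- Give the pendant edge a weight W ≥ 0 so large that W + α exceeds the total
-- weight of G, and take W + α as the new threshold. An edge set without the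
-- pendant edge then falls below the threshold, and indeed cannot connect the
-- new vertex; an edge set containing it reaches the threshold iff its old
-- edges reach α, i.e. iff they connect G, i.e. iff the whole set connects G_out.
module Submission where

open import Defs
open import Data.Fin using (Fin; zero; suc; inject₁; fromℕ)
open import Data.Fin.Properties using (fromℕ≢inject₁)
open import Data.Fin.Relation.Unary.Top using (view; ‵fromℕ; ‵inject₁; view-fromℕ; view-inject₁)
open import Data.Nat using (ℕ)
open import Data.Bool using (true; false; if_then_else_)
open import Data.Product using (_,_)
open import Data.Empty using (⊥-elim)
open import Data.Vec.Functional using (_∷_)
open import Data.Rational using (ℚ; 0ℚ; 1ℚ; _+_; _-_; -_; _⊔_; _≤_; _<_)
open import Data.Rational.Properties
  using (≤-refl; <-irrefl; <-≤-trans; ≤-<-trans; +-mono-≤; +-monoˡ-≤; +-monoʳ-≤; +-monoʳ-<;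
         +-identityˡ; +-identityʳ; positive⁻¹; p≤p⊔q; p≤q⊔p; +-0-group; module ≤-Reasoning)
open import Algebra.Properties.Group +-0-group using (\\-leftDividesʳ; //-rightDividesˡ)
open import Function using (_∘_; _⇔_; mk⇔; Equivalence)
open import Relation.Nullary using (¬_)
open import Relation.Binary.PropositionalEquality using (_≡_; refl; sym; trans; subst; subst₂)

Reach-trans : ∀ {G S x y z} → Reach G S x y → Reach G S y z → Reach G S x z
Reach-trans p here           = p
Reach-trans p (fwd i s q eq) = fwd i s (Reach-trans p q) eq
Reach-trans p (bwd i s q eq) = bwd i s (Reach-trans p q) eq

Reach-sym : ∀ {G S x y} → Reach G S x y → Reach G S y x
Reach-sym here             = here
Reach-sym (fwd i s q refl) = Reach-trans (bwd i s here refl) (Reach-sym q)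
Reach-sym (bwd i s q refl) = Reach-trans (fwd i s here refl) (Reach-sym q)

module Pendant (G : Graph) (u : Fin (n G)) where

  G⁺ : Graph
  G⁺ = addPendant G u

  restrict : EdgeSet G⁺ → EdgeSet G
  restrict S = S ∘ suc

  collapse : Fin (n G⁺) → Fin (n G)
  collapse a with view a
  ... | ‵fromℕ     = u
  ... | ‵inject₁ x = x

  collapse-fromℕ : collapse (fromℕ (n G)) ≡ u
  collapse-fromℕ rewrite view-fromℕ (n G) = refl

  collapse-inject₁ : ∀ x → collapse (inject₁ x) ≡ x
  collapse-inject₁ x rewrite view-inject₁ x = refl

  Reach-inject₁ : ∀ {S x y} → Reach G (restrict S) x y → Reach G⁺ S (inject₁ x) (inject₁ y)
  Reach-inject₁ here             = here
  Reach-inject₁ (fwd i s q refl) = fwd (suc i) s (Reach-inject₁ q) refl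
  Reach-inject₁ (bwd i s q refl) = bwd (suc i) s (Reach-inject₁ q) refl

  Reach-collapse : ∀ {S a b} → Reach G⁺ S a b → Reach G (restrict S) (collapse a) (collapse b)
  Reach-collapse here = here
  Reach-collapse (fwd zero s q refl) =
    subst (Reach G _ _) (trans (collapse-inject₁ u) (sym collapse-fromℕ)) (Reach-collapse q)
  Reach-collapse (bwd zero s q refl) =
    subst (Reach G _ _) (trans collapse-fromℕ (sym (collapse-inject₁ u))) (Reach-collapse q)
  Reach-collapse (fwd (suc i) s q refl) =
    fwd i s (subst (Reach G _ _) (collapse-inject₁ _) (Reach-collapse q)) (collapse-inject₁ _)
  Reach-collapse (bwd (suc i) s q refl) =
    bwd i s (subst (Reach G _ _) (collapse-inject₁ _) (Reach-collapse q)) (collapse-inject₁ _)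

  Reach-from-isolated-pendant : ∀ {S b} → S zero ≡ false →
                                Reach G⁺ S (fromℕ (n G)) b → b ≡ fromℕ (n G)
  Reach-from-isolated-pendant s₀ here = refl
  Reach-from-isolated-pendant s₀ (fwd zero s _ _) with () ← trans (sym s₀) s
  Reach-from-isolated-pendant s₀ (bwd zero s _ _) with () ← trans (sym s₀) s
  Reach-from-isolated-pendant s₀ (fwd (suc i) _ q _) =
    ⊥-elim (fromℕ≢inject₁ (sym (Reach-from-isolated-pendant s₀ q)))
  Reach-from-isolated-pendant s₀ (bwd (suc i) _ q _) =
    ⊥-elim (fromℕ≢inject₁ (sym (Reach-from-isolated-pendant s₀ q)))

  spanConnected-extend : ∀ S → S zero ≡ true →
                         SpanConnected G (restrict S) → SpanConnected G⁺ S
  spanConnected-extend S s₀ conn a b = Reach-trans (Reach-u a) (Reach-sym (Reach-u b))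
    where
    Reach-u : ∀ a → Reach G⁺ S a (inject₁ u)
    Reach-u a with view a
    ... | ‵fromℕ     = bwd zero s₀ here refl
    ... | ‵inject₁ x = Reach-inject₁ (conn x u)

  spanConnected-restrict : ∀ S → SpanConnected G⁺ S → SpanConnected G (restrict S)
  spanConnected-restrict S conn x y =
    subst₂ (Reach G _) (collapse-inject₁ x) (collapse-inject₁ y)
           (Reach-collapse (conn (inject₁ x) (inject₁ y)))

  ¬spanConnected-without-pendant : ∀ S → S zero ≡ false → ¬ SpanConnected G⁺ S
  ¬spanConnected-without-pendant S s₀ conn =
    fromℕ≢inject₁ (sym (Reach-from-isolated-pendant s₀ (conn (fromℕ (n G)) (inject₁ u))))

sumSel-≤-sumAll : ∀ {k} {w : Fin k → ℚ} → (∀ i → 0ℚ ≤ w i) →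
                  ∀ S → sumSel w S ≤ sumSel w (λ _ → true)
sumSel-≤-sumAll {ℕ.zero}          w≥0 S = ≤-refl
sumSel-≤-sumAll {ℕ.suc k} {w = w} w≥0 S =
  +-mono-≤ (selected-≤ (S zero)) (sumSel-≤-sumAll (w≥0 ∘ suc) (S ∘ suc))
  where
  selected-≤ : ∀ b → (if b then w zero else 0ℚ) ≤ w zero
  selected-≤ true  = ≤-refl
  selected-≤ false = w≥0 zero

+-cancelˡ-≤ : ∀ r {p q} → r + p ≤ r + q → p ≤ q
+-cancelˡ-≤ r {p} {q} r+p≤r+q =
  subst₂ _≤_ (\\-leftDividesʳ r p) (\\-leftDividesʳ r q) (+-monoʳ-≤ (- r) r+p≤r+q)

headroom : ℚ → ℚ → ℚ
headroom t α = 0ℚ ⊔ (t + 1ℚ - α)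

0≤headroom : ∀ t α → 0ℚ ≤ headroom t α
0≤headroom t α = p≤p⊔q 0ℚ (t + 1ℚ - α)

t<headroom+α : ∀ t α → t < headroom t α + α
t<headroom+α t α = begin-strict
  t                ≡⟨ sym (+-identityʳ t) ⟩
  t + 0ℚ           <⟨ +-monoʳ-< t (positive⁻¹ 1ℚ) ⟩
  t + 1ℚ           ≡⟨ sym (//-rightDividesˡ α (t + 1ℚ)) ⟩
  t + 1ℚ - α + α   ≤⟨ +-monoˡ-≤ α (p≤q⊔p 0ℚ (t + 1ℚ - α)) ⟩
  headroom t α + α ∎
  where open ≤-Reasoning

separable-addPendant : ∀ G u → Separable G → Separable (addPendant G u)
separable-addPendant G u (w , α , w≥0 , sep) = W ∷ w , W + α , w⁺≥0 , sep⁺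
  where
  open Pendant G u
  open Equivalence

  W : ℚ
  W = headroom (sumSel w (allEdges G)) α

  w⁺≥0 : ∀ i → 0ℚ ≤ (W ∷ w) i
  w⁺≥0 zero    = 0≤headroom (sumSel w (allEdges G)) α
  w⁺≥0 (suc i) = w≥0 i

  sep⁺ : ∀ S → (W + α ≤ sumSel (W ∷ w) S) ⇔ SpanConnected G⁺ S
  sep⁺ S with S zero in s₀
  ... | true  = mk⇔ (spanConnected-extend S s₀ ∘ to (sep (restrict S)) ∘ +-cancelˡ-≤ W)
                    (+-monoʳ-≤ W ∘ from (sep (restrict S)) ∘ spanConnected-restrict S)
  ... | false = mk⇔ (λ W+α≤ → ⊥-elim (<-irrefl refl (<-≤-trans too-light W+α≤)))
                    (⊥-elim ∘ ¬spanConnected-without-pendant S s₀)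
    where
    too-light : 0ℚ + sumSel w (restrict S) < W + α
    too-light = subst (_< W + α) (sym (+-identityˡ _))
                      (≤-<-trans (sumSel-≤-sumAll w≥0 (restrict S))
                                 (t<headroom+α (sumSel w (allEdges G)) α))

lemma3 : (G : Graph) → IsSimple G → Connected G →
         (u₁ : Fin (n G)) →
         Separable G → Separable (addPendant G u₁)
lemma3 G _ _ = separable-addPendant G
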